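{- Let $T$ be a tree of order $n\geq 3$ with diameter $\operatorname{diam}(T)=2$. Then $\gamma_t(M(T))=n-1$.
   Context: All graphs are finite and simple. $\operatorname{diam}(T)$ is the maximum distance between two vertices of $T$. For a graph $H$ with no isolated vertices, a total dominating set of $H$ is a set $S\subseteq V(H)$ such that every vertex of $H$ has at least one neighbor in $S$; $\gamma_t(H)$ is the minimum cardinality of a total dominating set. The middle graph $M(G)$ of a graph $G$ has vertex set $V(G)\cup E(G)$ (disjoint union), and two of its vertices $x,y$ are adjacent exactly when either $x,y\in E(G)$ are edges of $G$ sharing a common endpoint, or $x\in V(G)$, $y\in E(G)$ and $x$ is an endpoint of $y$ (no two elements of $V(G)$ are adjacent in $M(G)$). -}

module Defs where

open import Data.Nat using (ℕ; zero; suc; _≤_; _<_)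
open import Data.Fin using (Fin; toℕ)
open import Data.Bool using (Bool; true; false; T)
open import Data.Empty using (⊥)
open import Data.Product using (Σ; ∃; ∃-syntax; _×_; _,_)
open import Data.Sum using (_⊎_; inj₁; inj₂)
open import Data.List using (List; []; _∷_; _++_; length)
open import Data.List.Membership.Propositional using (_∈_)
open import Data.List.Relation.Unary.Unique.Propositional using (Unique)
open import Data.List.Relation.Unary.Linked using (Linked)
open import Relation.Binary.PropositionalEquality using (_≡_; _≢_)
open import Relation.Nullary using (¬_)

record SimpleGraph (n : ℕ) : Set where
  field
    adj    : Fin n → Fin n → Bool
    sym    : ∀ i j → adj i j ≡ adj j i
    irrefl : ∀ i → adj i i ≡ false

module _ {n : ℕ} (G : SimpleGraph n) where
  open SimpleGraph G

  Adj : Fin n → Fin n → Set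
  Adj i j = T (adj i j)

  data Walk : Fin n → Fin n → ℕ → Set where
    nil  : ∀ {u} → Walk u u zero
    cons : ∀ {u v w k} → Adj u v → Walk v w k → Walk u w (suc k)

  Connected : Set
  Connected = ∀ u v → ∃[ k ] Walk u v k

  HasCycle : Set
  HasCycle = Σ (Fin n) λ v → Σ (List (Fin n)) λ rest →
    (2 ≤ length rest) × Unique (v ∷ rest) × Linked Adj (v ∷ (rest ++ (v ∷ [])))

  Acyclic : Set
  Acyclic = ¬ HasCycle

  IsTree : Set
  IsTree = Connected × Acyclic

  Dist : Fin n → Fin n → ℕ → Set
  Dist u v d = Walk u v d × (∀ k → k < d → ¬ Walk u v k)

  Diameter : ℕ → Set
  Diameter d = (∀ u v → ∃[ k ] (k ≤ d × Dist u v k)) × (∃[ u ] ∃[ v ] Dist u v d)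

  -- edges of G: unordered pairs {i,j}, represented with toℕ i < toℕ j
  Edge : Set
  Edge = Σ (Fin n) λ i → Σ (Fin n) λ j → (toℕ i < toℕ j) × Adj i j

  Endpoint : Fin n → Edge → Set
  Endpoint x (i , j , _) = (x ≡ i) ⊎ (x ≡ j)

record Graph : Set₁ where
  field
    Vertex : Set
    Adjᴴ   : Vertex → Vertex → Set

open Graph public

IsTotalDominatingSet : (H : Graph) → List (Vertex H) → Set
IsTotalDominatingSet H S = ∀ v → ∃[ s ] (s ∈ S × Adjᴴ H v s)

TotalDominationNumber : (H : Graph) → ℕ → Set
TotalDominationNumber H m =
  (∃[ S ] (Unique S × IsTotalDominatingSet H S × length S ≡ m)) ×
  (∀ S → Unique S → IsTotalDominatingSet H S → m ≤ length S)

MiddleAdj : ∀ {n} (G : SimpleGraph n) → (Fin n ⊎ Edge G) → (Fin n ⊎ Edge G) → Set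
MiddleAdj G (inj₁ x) (inj₁ y) = ⊥
MiddleAdj G (inj₁ x) (inj₂ e) = Endpoint G x e
MiddleAdj G (inj₂ e) (inj₁ y) = Endpoint G y e
MiddleAdj G (inj₂ e) (inj₂ f) = (e ≢ f) × ∃[ x ] (Endpoint G x e × Endpoint G x f)

Middle : ∀ {n} → SimpleGraph n → Graph
Middle {n} G = record { Vertex = Fin n ⊎ Edge G ; Adjᴴ = MiddleAdj G }

-- An acyclic graph of diameter 2 is a star K₁,ₙ₋₁: its centre c is the middle of a
-- diametral path u–c–v, and a vertex at distance 2 from c would close a cycle of
-- length at most 5 with u or v.  In M(K₁,ₙ₋₁) the n − 1 spokes dominate every
-- vertex and every edge (two spokes always meet at c), while the n − 1 leaves have
-- pairwise disjoint neighbourhoods (each sees only its own spoke), so every total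
-- dominating set needs n − 1 distinct elements.
module Submission where

open import Defs
open import Data.Nat using (ℕ; _≤_; _∸_; suc; z≤n; s≤s)
open import Data.Nat.Properties using (<-cmp)
open import Data.Fin using (Fin; toℕ; punchIn; punchOut) renaming (zero to fzero; suc to fsuc)
open import Data.Fin.Properties
  using (_≟_; toℕ-injective; punchIn-injective; punchInᵢ≢i; punchIn-punchOut; injective⇒≤)
open import Data.Bool using (T)
open import Data.Empty using (⊥; ⊥-elim)
open import Data.Product using (∃-syntax; _×_; _,_; proj₁; proj₂)
open import Data.Sum using (_⊎_; inj₁; inj₂; swap)
open import Data.Sum.Properties using (inj₂-injective)
open import Data.List using (List; []; _∷_; length; map; allFin; lookup)
open import Data.List.Properties using (length-map; length-tabulate)
open import Data.List.Relation.Unary.Any using (index)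
open import Data.List.Relation.Unary.Any.Properties using (lookup-index)
open import Data.List.Membership.Propositional using (_∈_)
open import Data.List.Membership.Propositional.Properties using (∈-map⁺; ∈-allFin)
open import Data.List.Relation.Unary.Unique.Propositional using (Unique)
open import Data.List.Relation.Unary.Unique.Propositional.Properties using (map⁺; allFin⁺)
open import Data.List.Relation.Unary.All using ([]; _∷_)
open import Data.List.Relation.Unary.AllPairs using ([]; _∷_)
open import Data.List.Relation.Unary.Linked using ([-]; _∷_)
open import Function using (_∘_)
open import Function.Definitions using (Injective)
open import Relation.Binary.PropositionalEquality using (_≡_; _≢_; refl; sym; trans; subst)
open import Relation.Binary.Definitions using (tri<; tri≈; tri>)
open import Relation.Nullary using (¬_; yes; no)

disjointNeighbourhoods⇒≤length :
  (H : Graph) {m : ℕ} (f : Fin m → Vertex H) →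
  (∀ {i j s} → Adjᴴ H (f i) s → Adjᴴ H (f j) s → i ≡ j) →
  ∀ S → IsTotalDominatingSet H S → m ≤ length S
disjointNeighbourhoods⇒≤length H f disjoint S tds = injective⇒≤ position-injective
  where
  position : ∀ i → Fin (length S)
  position i = index (proj₁ (proj₂ (tds (f i))))

  lookup-position : ∀ i → Adjᴴ H (f i) (lookup S (position i))
  lookup-position i = subst (Adjᴴ H (f i)) (lookup-index (proj₁ (proj₂ (tds (f i)))))
                            (proj₂ (proj₂ (tds (f i))))

  position-injective : Injective _≡_ _≡_ position
  position-injective {i} {j} eq =
    disjoint (lookup-position i) (subst (Adjᴴ H (f j) ∘ lookup S) (sym eq) (lookup-position j))

∃-image-≢ : ∀ {m n} → 2 ≤ m → (f : Fin m → Fin n) → Injective _≡_ _≡_ f →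
            ∀ z → ∃[ k ] f k ≢ z
∃-image-≢ (s≤s (s≤s _)) f f-inj z with f fzero ≟ z
... | no f0≢z  = fzero , f0≢z
... | yes f0≡z = fsuc fzero , λ f1≡z → 1≢0 (f-inj (trans f1≡z (sym f0≡z)))
  where
  1≢0 : ∀ {k} → _≢_ {A = Fin (suc (suc k))} (fsuc fzero) fzero
  1≢0 ()

module SimpleGraphProperties {n : ℕ} (G : SimpleGraph n) where

  Adj-sym : ∀ {i j} → Adj G i j → Adj G j i
  Adj-sym {i} {j} = subst T (SimpleGraph.sym G i j)

  Adj⇒≢ : ∀ {i j} → Adj G i j → i ≢ j
  Adj⇒≢ {i} a refl = subst T (SimpleGraph.irrefl G i) a

  cycle₃ : ∀ {a b c} → Adj G a b → Adj G b c → Adj G c a → a ≢ c → HasCycle G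
  cycle₃ {a} {b} {c} ab bc ca a≢c = a , b ∷ c ∷ [] , s≤s (s≤s z≤n) ,
    ((Adj⇒≢ ab ∷ a≢c ∷ []) ∷ (Adj⇒≢ bc ∷ []) ∷ [] ∷ []) ,
    (ab ∷ bc ∷ ca ∷ [-])

  cycle₄ : ∀ {a b c d} → Adj G a b → Adj G b c → Adj G c d → Adj G d a →
           a ≢ c → b ≢ d → HasCycle G
  cycle₄ {a} {b} {c} {d} ab bc cd da a≢c b≢d = a , b ∷ c ∷ d ∷ [] , s≤s (s≤s z≤n) ,
    ((Adj⇒≢ ab ∷ a≢c ∷ Adj⇒≢ (Adj-sym da) ∷ []) ∷ (Adj⇒≢ bc ∷ b≢d ∷ []) ∷
      (Adj⇒≢ cd ∷ []) ∷ [] ∷ []) ,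
    (ab ∷ bc ∷ cd ∷ da ∷ [-])

  cycle₅ : ∀ {a b c d e} → Adj G a b → Adj G b c → Adj G c d → Adj G d e → Adj G e a →
           a ≢ c → a ≢ d → b ≢ d → b ≢ e → c ≢ e → HasCycle G
  cycle₅ {a} {b} {c} {d} {e} ab bc cd de ea a≢c a≢d b≢d b≢e c≢e =
    a , b ∷ c ∷ d ∷ e ∷ [] , s≤s (s≤s z≤n) ,
    ((Adj⇒≢ ab ∷ a≢c ∷ a≢d ∷ Adj⇒≢ (Adj-sym ea) ∷ []) ∷ (Adj⇒≢ bc ∷ b≢d ∷ b≢e ∷ []) ∷
      (Adj⇒≢ cd ∷ c≢e ∷ []) ∷ (Adj⇒≢ de ∷ []) ∷ [] ∷ []) ,
    (ab ∷ bc ∷ cd ∷ de ∷ ea ∷ [-])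

  toEdge : ∀ {i j} → Adj G i j → Edge G
  toEdge {i} {j} a with <-cmp (toℕ i) (toℕ j)
  ... | tri< lt _ _ = i , j , lt , a
  ... | tri≈ _ eq _ = ⊥-elim (Adj⇒≢ a (toℕ-injective eq))
  ... | tri> _ _ gt = j , i , gt , Adj-sym a

  toEdge-endpoint⁻ : ∀ {x i j} (a : Adj G i j) → Endpoint G x (toEdge a) → x ≡ i ⊎ x ≡ j
  toEdge-endpoint⁻ {i = i} {j} a ep with <-cmp (toℕ i) (toℕ j)
  ... | tri< _ _ _  = ep
  ... | tri≈ _ eq _ = ⊥-elim (Adj⇒≢ a (toℕ-injective eq))
  ... | tri> _ _ _  = swap ep

  toEdge-endpointˡ : ∀ {i j} (a : Adj G i j) → Endpoint G i (toEdge a)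
  toEdge-endpointˡ {i} {j} a with <-cmp (toℕ i) (toℕ j)
  ... | tri< _ _ _  = inj₁ refl
  ... | tri≈ _ eq _ = ⊥-elim (Adj⇒≢ a (toℕ-injective eq))
  ... | tri> _ _ _  = inj₂ refl

  toEdge-endpointʳ : ∀ {i j} (a : Adj G i j) → Endpoint G j (toEdge a)
  toEdge-endpointʳ {i} {j} a with <-cmp (toℕ i) (toℕ j)
  ... | tri< _ _ _  = inj₂ refl
  ... | tri≈ _ eq _ = ⊥-elim (Adj⇒≢ a (toℕ-injective eq))
  ... | tri> _ _ _  = inj₁ refl

  DistancesAtMost : ℕ → Set
  DistancesAtMost d = ∀ u v → ∃[ k ] (k ≤ d × Dist G u v k)

  -- A short walk from u to w closes a cycle of length 3, 4 or 5 through u, c, x, w.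
  distanceTwo⇒uniqueNeighbour :
    Acyclic G → DistancesAtMost 2 → ∀ {c x w u} →
    Adj G c x → Adj G x w → w ≢ c → ¬ Adj G c w → Adj G u c → u ≡ x
  distanceTwo⇒uniqueNeighbour acyc d≤2 {c} {x} {w} {u} cx xw w≢c c≁w uc with u ≟ x
  ... | yes u≡x = u≡x
  ... | no u≢x  = ⊥-elim (cycle-through-u (d≤2 u w))
    where
    cycle-through-u : ∃[ k ] (k ≤ 2 × Dist G u w k) → ⊥
    cycle-through-u (0 , _ , nil , _) = c≁w (Adj-sym uc)
    cycle-through-u (1 , _ , cons uw nil , _) =
      acyc (cycle₄ (Adj-sym uc) uw (Adj-sym xw) (Adj-sym cx) (w≢c ∘ sym) u≢x)
    cycle-through-u (2 , _ , cons {v = y} uy (cons yw nil) , _) with y ≟ x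
    ... | yes refl = acyc (cycle₃ (Adj-sym uc) uy (Adj-sym cx) (Adj⇒≢ cx))
    ... | no y≢x   = acyc (cycle₅ (Adj-sym uc) uy yw (Adj-sym xw) (Adj-sym cx)
                       (λ { refl → c≁w yw }) (w≢c ∘ sym) (λ { refl → c≁w (Adj-sym uc) })
                       u≢x y≢x)
    cycle-through-u (suc (suc (suc _)) , s≤s (s≤s ()) , _)

  acyclic∧diameter2⇒star : Acyclic G → Diameter G 2 → ∃[ c ] (∀ w → w ≢ c → Adj G c w)
  acyclic∧diameter2⇒star acyc (d≤2 , u , v , cons {v = c} uc (cons cv nil) , u-v-minimal) =
    c , adjacent
    where
    u≢v : u ≢ v
    u≢v refl = u-v-minimal 0 (s≤s z≤n) nil

    adjacent : ∀ w → w ≢ c → Adj G c w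
    adjacent w w≢c with d≤2 c w
    ... | 0 , _ , nil , _ = ⊥-elim (w≢c refl)
    ... | 1 , _ , cons cw nil , _ = cw
    ... | 2 , _ , cons {v = x} cx (cons xw nil) , c-w-minimal =
      ⊥-elim (u≢v (trans (uniqueNeighbour uc) (sym (uniqueNeighbour (Adj-sym cv)))))
      where
      uniqueNeighbour : ∀ {y} → Adj G y c → y ≡ x
      uniqueNeighbour = distanceTwo⇒uniqueNeighbour acyc d≤2 cx xw w≢c
                          (λ cw → c-w-minimal 1 (s≤s (s≤s z≤n)) (cons cw nil))
    ... | suc (suc (suc _)) , s≤s (s≤s ()) , _

module Star {m : ℕ} (G : SimpleGraph (suc m)) (acyc : Acyclic G) (c : Fin (suc m))
            (centre-adj : ∀ w → w ≢ c → Adj G c w) where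
  open SimpleGraphProperties G

  leaf : Fin m → Fin (suc m)
  leaf = punchIn c

  leaf-injective : Injective _≡_ _≡_ leaf
  leaf-injective = punchIn-injective c _ _

  leaf≢centre : ∀ k → leaf k ≢ c
  leaf≢centre = punchInᵢ≢i c

  leaves-nonadjacent : ∀ {w z} → Adj G w z → w ≢ c → z ≢ c → ⊥
  leaves-nonadjacent wz w≢c z≢c =
    acyc (cycle₃ wz (Adj-sym (centre-adj _ z≢c)) (centre-adj _ w≢c) w≢c)

  edge-has-centre : (e : Edge G) → ∃[ o ] (o ≢ c × Endpoint G o e × Endpoint G c e)
  edge-has-centre (i , j , _ , a) with i ≟ c | j ≟ c
  ... | yes refl | _       = j , Adj⇒≢ (Adj-sym a) , inj₂ refl , inj₁ refl
  ... | no i≢c   | yes refl = i , i≢c , inj₁ refl , inj₂ refl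
  ... | no i≢c   | no j≢c   = ⊥-elim (leaves-nonadjacent a i≢c j≢c)

  spoke : Fin m → Edge G
  spoke k = toEdge (centre-adj (leaf k) (leaf≢centre k))

  spoke-endpoint⁻ : ∀ {x} k → Endpoint G x (spoke k) → x ≡ c ⊎ x ≡ leaf k
  spoke-endpoint⁻ k = toEdge-endpoint⁻ (centre-adj (leaf k) (leaf≢centre k))

  centre∈spoke : ∀ k → Endpoint G c (spoke k)
  centre∈spoke k = toEdge-endpointˡ (centre-adj (leaf k) (leaf≢centre k))

  leaf∈spoke : ∀ k → Endpoint G (leaf k) (spoke k)
  leaf∈spoke k = toEdge-endpointʳ (centre-adj (leaf k) (leaf≢centre k))

  spoke-injective : Injective _≡_ _≡_ spoke
  spoke-injective {k} {k′} eq with spoke-endpoint⁻ k′ (subst (Endpoint G (leaf k)) eq (leaf∈spoke k))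
  ... | inj₁ leaf≡c = ⊥-elim (leaf≢centre k leaf≡c)
  ... | inj₂ leaf≡  = leaf-injective leaf≡

  spokes : List (Fin (suc m) ⊎ Edge G)
  spokes = map (inj₂ ∘ spoke) (allFin m)

  spokes-unique : Unique spokes
  spokes-unique = map⁺ (spoke-injective ∘ inj₂-injective) (allFin⁺ m)

  spokes-length : length spokes ≡ m
  spokes-length = trans (length-map (inj₂ ∘ spoke) (allFin m)) (length-tabulate (λ k → k))

  spoke∈spokes : ∀ k → inj₂ (spoke k) ∈ spokes
  spoke∈spokes k = ∈-map⁺ (inj₂ ∘ spoke) (∈-allFin k)

  spokes-totalDominating : 2 ≤ m → IsTotalDominatingSet (Middle G) spokes
  spokes-totalDominating 2≤m (inj₁ w) with w ≟ c
  ... | yes refl = let (k , _) = ∃-image-≢ 2≤m leaf leaf-injective c in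
                   inj₂ (spoke k) , spoke∈spokes k , centre∈spoke k
  ... | no w≢c   = inj₂ (spoke k) , spoke∈spokes k ,
                   subst (λ z → Endpoint G z (spoke k)) (punchIn-punchOut c≢w) (leaf∈spoke k)
    where
    c≢w = w≢c ∘ sym
    k = punchOut c≢w
  spokes-totalDominating 2≤m (inj₂ e) with edge-has-centre e
  ... | o , o≢c , o∈e , c∈e with ∃-image-≢ 2≤m leaf leaf-injective o
  ...   | k , leaf≢o = inj₂ (spoke k) , spoke∈spokes k , e≢spoke , c , c∈e , centre∈spoke k
    where
    e≢spoke : e ≢ spoke k
    e≢spoke e≡spoke with spoke-endpoint⁻ k (subst (Endpoint G o) e≡spoke o∈e)
    ... | inj₁ o≡c    = o≢c o≡c
    ... | inj₂ o≡leaf = leaf≢o (sym o≡leaf)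

  noncentral-endpoints-equal : ∀ {x y} e → Endpoint G x e → Endpoint G y e →
                               x ≢ c → y ≢ c → x ≡ y
  noncentral-endpoints-equal _                (inj₁ refl) (inj₁ refl) _   _   = refl
  noncentral-endpoints-equal (_ , _ , _ , ab) (inj₁ refl) (inj₂ refl) x≢c y≢c =
    ⊥-elim (leaves-nonadjacent ab x≢c y≢c)
  noncentral-endpoints-equal (_ , _ , _ , ab) (inj₂ refl) (inj₁ refl) x≢c y≢c =
    ⊥-elim (leaves-nonadjacent ab y≢c x≢c)
  noncentral-endpoints-equal _                (inj₂ refl) (inj₂ refl) _   _   = refl

  leaf-neighbourhoods-disjoint : ∀ {i j s} → MiddleAdj G (inj₁ (leaf i)) s →
                                 MiddleAdj G (inj₁ (leaf j)) s → i ≡ j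
  leaf-neighbourhoods-disjoint {i} {j} {inj₂ e} i∈e j∈e =
    leaf-injective (noncentral-endpoints-equal e i∈e j∈e (leaf≢centre i) (leaf≢centre j))

proposition3p5 : (n : ℕ) (T : SimpleGraph n) → 3 ≤ n → IsTree T → Diameter T 2 →
    TotalDominationNumber (Middle T) (n ∸ 1)
proposition3p5 (suc (suc (suc k))) T (s≤s (s≤s (s≤s _))) (_ , acyc) diam
  with SimpleGraphProperties.acyclic∧diameter2⇒star T acyc diam
... | c , centre-adj =
  (spokes , spokes-unique , spokes-totalDominating (s≤s (s≤s z≤n)) , spokes-length) ,
  λ S _ → disjointNeighbourhoods⇒≤length (Middle T) (inj₁ ∘ leaf) leaf-neighbourhoods-disjoint S
  where open Star T acyc c centre-adj
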